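{- For $n\ge 1$, let $\mathcal{F}_n\subseteq\mathcal{D}_n$ be the set of Dyck paths of size $n$ containing no peak with even $y$-coordinate and no valley with odd $x$-coordinate. Then $|\mathcal{F}_n|=0$ if $n$ is even, and $|\mathcal{F}_n|=c_k=\frac{1}{k+1}\binom{2k}{k}$ if $n=2k+1$.
   Context: A Dyck path of size $n$ is a lattice path in $\mathbb{Z}^2$ from $(0,0)$ to $(n,n)$ using steps $\mathsf{N}=(0,1)$ and $\mathsf{E}=(1,0)$ that never goes below $y=x$; $\mathcal{D}_n$ is the set of such paths. A peak is an occurrence of consecutive steps $\mathsf{N}\mathsf{E}$ and a valley an occurrence of consecutive steps $\mathsf{E}\mathsf{N}$; the coordinates of a peak or valley are those of the lattice point where its $\mathsf{N}$ step and $\mathsf{E}$ step meet. -}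

module Defs where

open import Data.Bool using (Bool; true; false; _∧_; not; T)
open import Data.Bool.Properties using (T?)
open import Data.Nat using (ℕ; zero; suc; _+_; _*_; _≡ᵇ_; _<ᵇ_)
open import Data.List using (List; []; _∷_; length; map; filter; concatMap)

-- Steps of a lattice path: N = (0,1), E = (1,0).
data Step : Set where
  N E : Step

words : ℕ → List (List Step)
words zero    = [] ∷ []
words (suc m) = concatMap (λ w → (N ∷ w) ∷ (E ∷ w) ∷ []) (words m)

-- dyckFrom x y w: starting at (x , y), the path w never goes below y = x
-- (checked after every E step, the only step that can go down relative to
-- the diagonal) and ends on the diagonal.
dyckFrom : ℕ → ℕ → List Step → Bool
dyckFrom x y []      = x ≡ᵇ y
dyckFrom x y (N ∷ w) = dyckFrom x (suc y) w
dyckFrom x y (E ∷ w) = ((suc x) <ᵇ (suc y)) ∧ dyckFrom (suc x) y w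

isDyck : ℕ → List Step → Bool
isDyck n w = (length w ≡ᵇ (n + n)) ∧ dyckFrom 0 0 w

isEven : ℕ → Bool
isEven zero          = true
isEven (suc zero)    = false
isEven (suc (suc m)) = isEven m

-- goodFrom x y w: starting at (x , y), w has no peak (N followed by E) whose
-- meeting point has even y-coordinate, and no valley (E followed by N) whose
-- meeting point has odd x-coordinate.
goodFrom : ℕ → ℕ → List Step → Bool
goodFrom x y []            = true
goodFrom x y (N ∷ [])      = true
goodFrom x y (E ∷ [])      = true
goodFrom x y (N ∷ N ∷ w)   = goodFrom x (suc y) (N ∷ w)
goodFrom x y (N ∷ E ∷ w)   = not (isEven (suc y)) ∧ goodFrom x (suc y) (E ∷ w)
goodFrom x y (E ∷ E ∷ w)   = goodFrom (suc x) y (E ∷ w)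
goodFrom x y (E ∷ N ∷ w)   = isEven (suc x) ∧ goodFrom (suc x) y (N ∷ w)

inF : ℕ → List Step → Bool
inF n w = isDyck n w ∧ goodFrom 0 0 w

F : ℕ → List (List Step)
F n = filter (λ w → T? (inF n w)) (words (n + n))

{-# OPTIONS --safe #-}
-- Read a path step by step, remembering the previous step so that every peak and valley is
-- checked at its corner. After the initial N the path stands at a point (x, y) with x even and
-- y odd, and from such a point the next two steps must be NN or EE: after N the height is even,
-- so an E would make a forbidden peak, and after E the abscissa is odd, so an N would make a
-- forbidden valley. Translating by (2, 2) changes neither parities nor the position relative to
-- the diagonal, so these points normalise to (0, 2h + 1). Reading the path in pairs of steps
-- between the initial N and the final E therefore gives a Dyck path with n steps, so
-- |F (n + 1)| is the number of those: none for n odd and c_k for n = 2k, by the ballot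
-- identity c_k + C(2k, k + 1) = C(2k, k) and (k + 1) C(2k, k + 1) = k C(2k, k).
module Submission where

open import Defs
open import Data.Nat using (ℕ; suc; _+_; _*_; _≤_; _/_)
open import Data.Nat.Combinatorics using (_C_)
open import Data.List using (length)
open import Data.Product using (_×_)
open import Relation.Binary.PropositionalEquality using (_≡_)

import Algebra.Properties.CommutativeSemigroup as CommSemigroupProperties
open import Data.Bool using (Bool; true; false; _∧_; not; if_then_else_)
open import Data.Bool.Properties using (T?; T-≡; ∧-comm; ∧-zeroʳ)
open import Data.List using (List; []; _∷_; filter; concatMap)
open import Data.Nat using (zero; _<_; s≤s; _≡ᵇ_; _<ᵇ_)
open import Data.Nat.Combinatorics using (nC1≡n; k>n⇒nCk≡0)
  renaming (nCk+nC[k+1]≡[n+1]C[k+1] to pascal)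
open import Data.Nat.DivMod using (m*n/n≡m)
open import Data.Nat.Properties
open import Data.Product using (_,_)
open import Function using (_∘_; Equivalence)
open import Relation.Binary.PropositionalEquality
  using (refl; sym; trans; cong; cong₂; module ≡-Reasoning)

open CommSemigroupProperties +-commutativeSemigroup using (interchange; x∙yz≈xz∙y)
open ≡-Reasoning

count : ℕ → (List Step → Bool) → ℕ
count zero    P = if P [] then 1 else 0
count (suc m) P = count m (P ∘ (N ∷_)) + count m (P ∘ (E ∷_))

countIn : ∀ {A : Set} → (A → Bool) → List A → ℕ
countIn P xs = length (filter (T? ∘ P) xs)

countIn-∷ : ∀ {A : Set} (P : A → Bool) x xs →
            countIn P (x ∷ xs) ≡ (if P x then 1 else 0) + countIn P xs
countIn-∷ P x xs with P x
... | true  = refl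
... | false = refl

extensions : List (List Step) → List (List Step)
extensions = concatMap (λ w → (N ∷ w) ∷ (E ∷ w) ∷ [])

countIn-extensions : ∀ P ws →
  countIn P (extensions ws) ≡ countIn (P ∘ (N ∷_)) ws + countIn (P ∘ (E ∷_)) ws
countIn-extensions P []       = refl
countIn-extensions P (w ∷ ws) = begin
  countIn P ((N ∷ w) ∷ (E ∷ w) ∷ extensions ws)
    ≡⟨ countIn-∷ P _ _ ⟩
  a + countIn P ((E ∷ w) ∷ extensions ws)
    ≡⟨ cong (a +_) (countIn-∷ P _ _) ⟩
  a + (b + countIn P (extensions ws))
    ≡⟨ cong (λ n → a + (b + n)) (countIn-extensions P ws) ⟩
  a + (b + (c + d))
    ≡⟨ +-assoc a b (c + d) ⟨
  (a + b) + (c + d)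
    ≡⟨ interchange a b c d ⟩
  (a + c) + (b + d)
    ≡⟨ cong₂ _+_ (countIn-∷ (P ∘ (N ∷_)) w ws) (countIn-∷ (P ∘ (E ∷_)) w ws) ⟨
  countIn (P ∘ (N ∷_)) (w ∷ ws) + countIn (P ∘ (E ∷_)) (w ∷ ws) ∎
  where
  a = if P (N ∷ w) then 1 else 0
  b = if P (E ∷ w) then 1 else 0
  c = countIn (P ∘ (N ∷_)) ws
  d = countIn (P ∘ (E ∷_)) ws

countIn-words : ∀ m P → countIn P (words m) ≡ count m P
countIn-words zero    P = trans (countIn-∷ P [] []) (+-identityʳ _)
countIn-words (suc m) P = trans (countIn-extensions P (words m))
  (cong₂ _+_ (countIn-words m (P ∘ (N ∷_))) (countIn-words m (P ∘ (E ∷_))))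

count-cong : ∀ m {P Q : List Step → Bool} →
             (∀ w → length w ≡ m → P w ≡ Q w) → count m P ≡ count m Q
count-cong zero    P≗Q = cong (λ b → if b then 1 else 0) (P≗Q [] refl)
count-cong (suc m) P≗Q = cong₂ _+_
  (count-cong m (λ w len → P≗Q (N ∷ w) (cong suc len)))
  (count-cong m (λ w len → P≗Q (E ∷ w) (cong suc len)))

count-false : ∀ m {P : List Step → Bool} → (∀ w → P w ≡ false) → count m P ≡ 0
count-false zero    {P} P≗false rewrite P≗false [] = refl
count-false (suc m)     P≗false = cong₂ _+_
  (count-false m (P≗false ∘ (N ∷_)))
  (count-false m (P≗false ∘ (E ∷_)))

allowedTurn : Step → Step → ℕ → ℕ → Bool
allowedTurn N E x y = not (isEven y)
allowedTurn E N x y = isEven x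
allowedTurn N N x y = true
allowedTurn E E x y = true

goodAfter : Step → ℕ → ℕ → List Step → Bool
goodAfter p x y []      = true
goodAfter p x y (N ∷ w) = allowedTurn p N x y ∧ goodAfter N x (suc y) w
goodAfter p x y (E ∷ w) = allowedTurn p E x y ∧ goodAfter E (suc x) y w

goodFrom-N : ∀ x y w → goodFrom x y (N ∷ w) ≡ goodAfter N x (suc y) w
goodFrom-E : ∀ x y w → goodFrom x y (E ∷ w) ≡ goodAfter E (suc x) y w
goodFrom-N x y []      = refl
goodFrom-N x y (N ∷ w) = goodFrom-N x (suc y) w
goodFrom-N x y (E ∷ w) = cong (not (isEven (suc y)) ∧_) (goodFrom-E x (suc y) w)
goodFrom-E x y []      = refl
goodFrom-E x y (N ∷ w) = cong (isEven (suc x) ∧_) (goodFrom-N (suc x) y w)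
goodFrom-E x y (E ∷ w) = goodFrom-E (suc x) y w

-- Entering the origin by an E step is harmless: its abscissa 0 is even.
goodFrom-origin : ∀ w → goodFrom 0 0 w ≡ goodAfter E 0 0 w
goodFrom-origin []      = refl
goodFrom-origin (N ∷ w) = goodFrom-N 0 0 w
goodFrom-origin (E ∷ w) = goodFrom-E 0 0 w

accepted : Step → ℕ → ℕ → List Step → Bool
accepted p x y w = goodAfter p x y w ∧ dyckFrom x y w

inF≡accepted : ∀ n w → length w ≡ n + n → inF n w ≡ accepted E 0 0 w
inF≡accepted n w len = begin
  ((length w ≡ᵇ n + n) ∧ dyckFrom 0 0 w) ∧ goodFrom 0 0 w
    ≡⟨ cong (λ b → (b ∧ dyckFrom 0 0 w) ∧ goodFrom 0 0 w)
            (Equivalence.to T-≡ (≡⇒≡ᵇ _ _ len)) ⟩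
  dyckFrom 0 0 w ∧ goodFrom 0 0 w     ≡⟨ ∧-comm (dyckFrom 0 0 w) _ ⟩
  goodFrom 0 0 w ∧ dyckFrom 0 0 w     ≡⟨ cong (_∧ dyckFrom 0 0 w) (goodFrom-origin w) ⟩
  accepted E 0 0 w                    ∎

length-F : ∀ n → length (F n) ≡ count (n + n) (accepted E 0 0)
length-F n = trans (countIn-words (n + n) (inF n)) (count-cong (n + n) (inF≡accepted n))

allowedTurn-shift : ∀ p s x y → allowedTurn p s (2 + x) (2 + y) ≡ allowedTurn p s x y
allowedTurn-shift N N _ _ = refl
allowedTurn-shift N E _ _ = refl
allowedTurn-shift E N _ _ = refl
allowedTurn-shift E E _ _ = refl

goodAfter-shift : ∀ p x y w → goodAfter p (2 + x) (2 + y) w ≡ goodAfter p x y w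
goodAfter-shift p x y []      = refl
goodAfter-shift p x y (N ∷ w) =
  cong₂ _∧_ (allowedTurn-shift p N x y) (goodAfter-shift N x (suc y) w)
goodAfter-shift p x y (E ∷ w) =
  cong₂ _∧_ (allowedTurn-shift p E x y) (goodAfter-shift E (suc x) y w)

dyckFrom-shift : ∀ x y w → dyckFrom (suc x) (suc y) w ≡ dyckFrom x y w
dyckFrom-shift x y []      = refl
dyckFrom-shift x y (N ∷ w) = dyckFrom-shift x (suc y) w
dyckFrom-shift x y (E ∷ w) = cong ((suc x <ᵇ suc y) ∧_) (dyckFrom-shift (suc x) y w)

accepted-shift : ∀ p x y w → accepted p (2 + x) (2 + y) w ≡ accepted p x y w
accepted-shift p x y w = cong₂ _∧_ (goodAfter-shift p x y w)
  (trans (dyckFrom-shift (suc x) (suc y) w) (dyckFrom-shift x y w))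

double : ℕ → ℕ
double zero    = zero
double (suc n) = suc (suc (double n))

double[n]≡n+n : ∀ n → double n ≡ n + n
double[n]≡n+n zero    = refl
double[n]≡n+n (suc n) = cong suc (trans (cong suc (double[n]≡n+n n)) (sym (+-suc n n)))

double[n]≡2*n : ∀ n → double n ≡ 2 * n
double[n]≡2*n n = trans (double[n]≡n+n n) (cong (n +_) (sym (+-identityʳ n)))

isEven-double : ∀ n → isEven (double n) ≡ true
isEven-double zero    = refl
isEven-double (suc n) = isEven-double n

isEven-suc-double : ∀ n → isEven (suc (double n)) ≡ false
isEven-suc-double zero    = refl
isEven-suc-double (suc n) = isEven-suc-double n

dyckCompletions : ℕ → ℕ → ℕ
dyckCompletions zero    zero    = 1
dyckCompletions zero    (suc h) = 0
dyckCompletions (suc m) zero    = dyckCompletions m 1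
dyckCompletions (suc m) (suc h) = dyckCompletions m (suc (suc h)) + dyckCompletions m h

free-step : ∀ k h p →
  count (suc k) (accepted p 0 (suc (double h)))
    ≡ count k (accepted N 0 (double (suc h))) + count k (accepted E 1 (suc (double h)))
free-step k h N rewrite isEven-suc-double h = refl
free-step k h E = refl

N-forces-N : ∀ k h →
  count (suc k) (accepted N 0 (double (suc h))) ≡ count k (accepted N 0 (suc (double (suc h))))
N-forces-N k h rewrite isEven-double h = begin
  count k (accepted N 0 (suc (double (suc h)))) + count k (λ _ → false)
    ≡⟨ cong (count k (accepted N 0 (suc (double (suc h)))) +_) (count-false k (λ _ → refl)) ⟩
  count k (accepted N 0 (suc (double (suc h)))) + 0
    ≡⟨ +-identityʳ _ ⟩
  count k (accepted N 0 (suc (double (suc h)))) ∎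

E-forces-E : ∀ k h →
  count (suc k) (accepted E 1 (suc (double (suc h)))) ≡ count k (accepted E 0 (suc (double h)))
E-forces-E k h = cong₂ _+_ (count-false k (λ _ → refl))
  (count-cong k (λ w _ → accepted-shift E 0 (suc (double h)) w))

E-blocked-on-diagonal : ∀ k → count (suc k) (accepted E 1 1) ≡ 0
E-blocked-on-diagonal k = cong₂ _+_
  (count-false k (λ _ → refl))
  (count-false k (λ w → ∧-zeroʳ (goodAfter E 2 1 w)))

count-accepted≡dyckCompletions : ∀ m h p →
  count (suc (double m)) (accepted p 0 (suc (double h))) ≡ dyckCompletions m h
branches≡dyckCompletions : ∀ m h →
  count (double m) (accepted N 0 (double (suc h))) + count (double m) (accepted E 1 (suc (double h)))
    ≡ dyckCompletions m h
count-accepted≡dyckCompletions m h p =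
  trans (free-step (double m) h p) (branches≡dyckCompletions m h)
branches≡dyckCompletions zero    zero    = refl
branches≡dyckCompletions zero    (suc h) = refl
branches≡dyckCompletions (suc m) zero    = trans
  (cong₂ _+_
    (trans (N-forces-N (suc (double m)) 0) (count-accepted≡dyckCompletions m 1 N))
    (E-blocked-on-diagonal (suc (double m))))
  (+-identityʳ _)
branches≡dyckCompletions (suc m) (suc h) = cong₂ _+_
  (trans (N-forces-N (suc (double m)) (suc h)) (count-accepted≡dyckCompletions m (suc (suc h)) N))
  (trans (E-forces-E (suc (double m)) h) (count-accepted≡dyckCompletions m h E))

length-F-suc : ∀ n → length (F (suc n)) ≡ dyckCompletions n 0
length-F-suc n = begin
  length (F (suc n))
    ≡⟨ length-F (suc n) ⟩
  count (suc n + suc n) (accepted E 0 0)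
    ≡⟨ cong (λ m → count m (accepted E 0 0)) (double[n]≡n+n (suc n)) ⟨
  count (suc (suc (double n))) (accepted E 0 0)
    ≡⟨ cong₂ _+_ (count-accepted≡dyckCompletions n 0 N)
                 (count-false (suc (double n)) (λ w → ∧-zeroʳ (goodAfter E 1 0 w))) ⟩
  dyckCompletions n 0 + 0
    ≡⟨ +-identityʳ _ ⟩
  dyckCompletions n 0 ∎

dyckCompletions-odd : ∀ m h → isEven (h + m) ≡ false → dyckCompletions m h ≡ 0
dyckCompletions-odd zero    zero    ()
dyckCompletions-odd zero    (suc h) _   = refl
dyckCompletions-odd (suc m) zero    odd = dyckCompletions-odd m 1 odd
dyckCompletions-odd (suc m) (suc h) odd rewrite +-suc h m =
  cong₂ _+_ (dyckCompletions-odd m (suc (suc h)) odd) (dyckCompletions-odd m h odd)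

dyckCompletions-short : ∀ m h → m < h → dyckCompletions m h ≡ 0
dyckCompletions-short zero    (suc h) _         = refl
dyckCompletions-short (suc m) (suc h) (s≤s m<h) =
  cong₂ _+_ (dyckCompletions-short m (suc (suc h)) (m<n⇒m<1+n (m<n⇒m<1+n m<h)))
            (dyckCompletions-short m h m<h)

dyckCompletions-diag : ∀ h → dyckCompletions h h ≡ 1
dyckCompletions-diag zero    = refl
dyckCompletions-diag (suc h) =
  cong₂ _+_ (dyckCompletions-short h (suc (suc h)) (m<n⇒m<1+n (n<1+n h))) (dyckCompletions-diag h)

-- Reflection principle: of the C(n, p) walks of n = h + 2p steps ±1 from height h down to 0,
-- those touching -1 correspond to walks ending at -2, and there are C(n, p - 1) = C(n, p + h + 1).
ballot : ∀ p h →
  dyckCompletions (h + double p) h + (h + double p) C suc (h + p) ≡ (h + double p) C p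
ballot zero h rewrite +-identityʳ h =
  cong₂ _+_ (dyckCompletions-diag h) (k>n⇒nCk≡0 (n<1+n h))
ballot (suc p) zero = begin
  W + suc (suc d) C suc (suc p)               ≡⟨ cong (W +_) (pascal (suc d) (suc p)) ⟨
  W + (suc d C suc p + suc d C suc (suc p))   ≡⟨ x∙yz≈xz∙y W _ _ ⟩
  (W + suc d C suc (suc p)) + suc d C suc p   ≡⟨ cong (_+ suc d C suc p) (ballot p 1) ⟩
  suc d C p + suc d C suc p                   ≡⟨ pascal (suc d) p ⟩
  suc (suc d) C suc p                         ∎
  where
  d = double p
  W = dyckCompletions (suc d) 1
ballot (suc p) (suc h) = begin
  (W₊ + W₋) + suc n C suc k
    ≡⟨ cong ((W₊ + W₋) +_) (trans (+-comm (n C suc k) (n C k)) (pascal n k)) ⟨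
  (W₊ + W₋) + (n C suc k + n C k)
    ≡⟨ interchange W₊ W₋ _ _ ⟩
  (W₊ + n C suc k) + (W₋ + n C k)
    ≡⟨ cong₂ _+_ ballot₊ (ballot (suc p) h) ⟩
  n C p + n C suc p
    ≡⟨ pascal n p ⟩
  suc n C suc p ∎
  where
  n  = h + double (suc p)
  k  = suc (h + suc p)
  W₊ = dyckCompletions n (suc (suc h))
  W₋ = dyckCompletions n h
  ballot₊ : dyckCompletions (h + suc (suc (double p))) (suc (suc h))
              + (h + suc (suc (double p))) C suc (suc (h + suc p))
            ≡ (h + suc (suc (double p))) C p
  ballot₊ rewrite +-suc h (suc (double p)) | +-suc h (double p) | +-suc h p = ballot p (suc (suc h))

absorption : ∀ n k → suc k * (suc n C suc k) ≡ suc n * (n C k)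
absorption n       zero    =
  trans (*-identityˡ _) (trans (nC1≡n (suc n)) (sym (*-identityʳ (suc n))))
absorption zero    (suc k) = *-zeroʳ (suc (suc k))
absorption (suc n) (suc k) = begin
  suc (suc k) * (suc (suc n) C suc (suc k))
    ≡⟨ cong (suc (suc k) *_) (pascal (suc n) (suc k)) ⟨
  suc (suc k) * (A + suc n C suc (suc k))
    ≡⟨ *-distribˡ-+ (suc (suc k)) A _ ⟩
  (A + suc k * A) + suc (suc k) * (suc n C suc (suc k))
    ≡⟨ cong₂ (λ u v → (A + u) + v) (absorption n k) (absorption n (suc k)) ⟩
  (A + suc n * (n C k)) + suc n * (n C suc k)
    ≡⟨ +-assoc A _ _ ⟩
  A + (suc n * (n C k) + suc n * (n C suc k))
    ≡⟨ cong (A +_) (*-distribˡ-+ (suc n) (n C k) (n C suc k)) ⟨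
  A + suc n * (n C k + n C suc k)
    ≡⟨ cong (λ u → A + suc n * u) (pascal n k) ⟩
  suc (suc n) * A ∎
  where
  A = suc n C suc k

central-binomial-ratio : ∀ k → suc k * (double k C suc k) ≡ k * (double k C k)
central-binomial-ratio k = +-cancelˡ-≡ (suc k * X) _ _ (begin
  suc k * X + suc k * Y       ≡⟨ *-distribˡ-+ (suc k) X Y ⟨
  suc k * (X + Y)             ≡⟨ cong (suc k *_) (pascal n k) ⟩
  suc k * (suc n C suc k)     ≡⟨ absorption n k ⟩
  suc n * X                   ≡⟨ cong (λ m → suc m * X) (double[n]≡n+n k) ⟩
  (suc k + k) * X             ≡⟨ *-distribʳ-+ X (suc k) k ⟩
  suc k * X + k * X           ∎)
  where
  n = double k
  X = n C k
  Y = n C suc k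

catalan : ∀ k → dyckCompletions (double k) 0 * suc k ≡ double k C k
catalan k = +-cancelʳ-≡ (k * X) _ _ (begin
  W * suc k + k * X           ≡⟨ cong (W * suc k +_) (central-binomial-ratio k) ⟨
  W * suc k + suc k * Y       ≡⟨ cong (_+ suc k * Y) (*-comm W (suc k)) ⟩
  suc k * W + suc k * Y       ≡⟨ *-distribˡ-+ (suc k) W Y ⟨
  suc k * (W + Y)             ≡⟨ cong (suc k *_) (ballot k 0) ⟩
  X + k * X                   ∎)
  where
  W = dyckCompletions (double k) 0
  X = double k C k
  Y = double k C suc k

lemma3p5 : (∀ k → 1 ≤ 2 * k → length (F (2 * k)) ≡ 0)
    × (∀ k → length (F (2 * k + 1)) ≡ ((2 * k) C k) / suc k)
lemma3p5 = F-even , F-odd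
  where
  F-even : ∀ k → 1 ≤ 2 * k → length (F (2 * k)) ≡ 0
  F-even (suc k) _ = begin
    length (F (2 * suc k))
      ≡⟨ cong (length ∘ F) (double[n]≡2*n (suc k)) ⟨
    length (F (suc (suc (double k))))
      ≡⟨ length-F-suc (suc (double k)) ⟩
    dyckCompletions (suc (double k)) 0
      ≡⟨ dyckCompletions-odd (suc (double k)) 0 (isEven-suc-double k) ⟩
    0 ∎
  F-odd : ∀ k → length (F (2 * k + 1)) ≡ ((2 * k) C k) / suc k
  F-odd k = begin
    length (F (2 * k + 1))
      ≡⟨ cong (length ∘ F) (trans (+-comm (2 * k) 1) (cong suc (sym (double[n]≡2*n k)))) ⟩
    length (F (suc (double k)))
      ≡⟨ length-F-suc (double k) ⟩
    W
      ≡⟨ m*n/n≡m W (suc k) ⟨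
    W * suc k / suc k
      ≡⟨ cong (_/ suc k) (catalan k) ⟩
    (double k C k) / suc k
      ≡⟨ cong (λ n → (n C k) / suc k) (double[n]≡2*n k) ⟩
    ((2 * k) C k) / suc k ∎
    where
    W = dyckCompletions (double k) 0
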